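{- For $i\in\mathbb N=\{0,1,2,\dots\}$ and a function $f:X\to Y$ between finite sets, let $\varphi_i(f)=\#\{y\in Y\mid \#f^{ -1}(y)=i\}$. For $i\in\mathbb N\setminus\{1\}$, each $\varphi_i$ induces a well-defined additive monotone $F_i:[f]\mapsto\varphi_i(f)$ on the ordered monoid $(\lvert\mathrm{PCD}(\mathbf{Set},\mathbf{Bij})\rvert,\succeq,\sqcup)$, i.e. $F_i$ is order-preserving into $(\mathbb R,\ge)$ and a monoid homomorphism into $(\mathbb R,+)$; and the family $\{F_i\}_{i\in\mathbb N\setminus\{1\}}$ is complete: for all functions $f,g$ between finite sets, $f\succeq g$ if and only if $\varphi_i(f)\ge\varphi_i(g)$ for all $i\in\mathbb N\setminus\{1\}$.
   Context: $\mathbf{Set}$ is the symmetric monoidal category of finite sets and functions with monoidal product disjoint union $\sqcup$; $\mathbf{Bij}$ is its subcategory of all finite sets and bijections. For functions $f,g$ between finite sets, $f\succeq g$ means there exist a finite set $Z$, bijections $\xi_1,\xi_2$ and a function $j$ between finite sets with $\xi_2\circ(f\sqcup 1_Z)\circ\xi_1=g\sqcup j$. This is a preorder compatible with $\sqcup$; $(\lvert\mathrm{PCD}(\mathbf{Set},\mathbf{Bij})\rvert,\succeq,\sqcup)$ is the commutative ordered monoid of equivalence classes $[f]$ under mutual $\succeq$, with $[f]\sqcup[g]=[f\sqcup g]$ and unit the class of identity functions. $\#S$ denotes the cardinality of $S$. -}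

module Defs where

open import Data.Nat using (ℕ; _+_; _≟_)
open import Data.Fin using (Fin; splitAt; join)
import Data.Fin as F
open import Data.Fin.Properties using (_≟_)
open import Data.List using (List; length; filter)
open import Data.List.Base using ()
open import Data.Sum.Base using (map)
open import Data.Product using (Σ; _×_; ∃; ∃-syntax)
open import Function.Bundles using (_⤖_; Bijection)
open import Relation.Binary.PropositionalEquality using (_≡_)

record FinFun : Set where
  constructor mkFun
  field
    dom : ℕ
    cod : ℕ
    fun : Fin dom → Fin cod
open FinFun public

allFin : ∀ n → List (Fin n)
allFin = Data.List.allFin

_⊔_ : FinFun → FinFun → FinFun
mkFun a b f ⊔ mkFun c d g = mkFun (a + c) (b + d) (λ x → join b d (map f g (splitAt a x)))

idFun : ℕ → FinFun
idFun n = mkFun n n (λ x → x)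

_≽_ : FinFun → FinFun → Set
f ≽ g =
  ∃[ z ] Σ FinFun λ j →
  Σ (Fin (dom (g ⊔ j)) ⤖ Fin (dom (f ⊔ idFun z))) λ ξ₁ →
  Σ (Fin (cod (f ⊔ idFun z)) ⤖ Fin (cod (g ⊔ j))) λ ξ₂ →
  ∀ x → Bijection.to ξ₂ (fun (f ⊔ idFun z) (Bijection.to ξ₁ x)) ≡ fun (g ⊔ j) x

fiberSize : (f : FinFun) → Fin (cod f) → ℕ
fiberSize f y = length (filter (λ x → fun f x F.≟ y) (allFin (dom f)))

φ : ℕ → FinFun → ℕ
φ i f = length (filter (λ y → fiberSize f y Data.Nat.≟ i) (allFin (cod f)))

-- Up to bijections of source and target, a map of finite sets is determined by the multiset
-- of its fibre sizes: splitting off the fibre over one point at a time shows that it is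
-- isomorphic to a disjoint union of collapsing maps k → 1, one per fibre. Since φ i counts
-- fibres of size i, it is invariant and additive, and it vanishes on identities for i ≢ 1
-- (their fibres are singletons); so f ⊔ 1_Z ≅ g ⊔ j forces φ i f ≥ φ i g. Conversely, if
-- φ i f ≥ φ i g for all i ≢ 1, then adding to f one singleton fibre (via 1_Z) for each
-- singleton fibre of g makes the fibre multiset of f ⊔ 1_Z contain that of g, and the
-- complementary multiset is realised by the map j.

module Submission where

open import Defs
open import Level using (Level)
open import Data.Nat using (ℕ; zero; suc; _+_; _≤_; _≥_; _<_; _≟_; s≤s; z≤n)
open import Data.Nat.Properties
  using (+-0-commutativeMonoid; +-assoc; +-identityʳ; +-cancelˡ-≤; ≤-trans; ≤-antisym; m≤m+n; m≤n+m; module ≤-Reasoning)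
open import Algebra.Properties.CommutativeMonoid.Sum +-0-commutativeMonoid using (sum; sum-permute)
open import Data.Fin using (Fin; zero; suc; splitAt; join; _↑ˡ_; _↑ʳ_)
import Data.Fin as Fin
open import Data.Fin.Properties using (+↔⊎; splitAt-join; splitAt-↑ˡ; splitAt-↑ʳ; ↑ˡ-injective; ↑ʳ-injective; suc-injective)
open import Data.List using (List; []; _∷_; _++_; length; filter; tabulate; replicate)
open import Data.List.Properties
  using (filter-≐; filter-all; filter-none; filter-accept; filter-reject; filter-++; length-++; length-tabulate; length-replicate)
import Data.List.Relation.Unary.All.Properties as All
open import Data.List.Relation.Binary.Permutation.Propositional using (_↭_; ↭-refl; ↭-trans; ↭-prep; ↭-swap)
import Data.List.Relation.Binary.Permutation.Propositional as ↭
open import Data.List.Relation.Binary.Permutation.Propositional.Properties using (↭-length; filter-↭)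
open import Data.Product using (∃; _×_; _,_)
open import Data.Sum as Sum using (_⊎_; inj₁; inj₂)
open import Data.Sum.Algebra using (⊎-cong; ⊎-comm; ⊎-assoc)
import Data.Vec.Functional as Vector
open import Function using (_∘_; _↔_; _⇔_; mk⇔; Inverse; Injection)
open import Function.Definitions using (Injective)
open import Function.Properties.Bijection using (⤖⇒↔)
open import Function.Properties.Inverse using (↔-refl; ↔-sym; ↔-trans; ↔⇒↣; ↔⇒⤖)
open import Relation.Nullary using (Dec; yes; no; ¬_)
open import Relation.Unary using (Pred; Decidable; _≐_)
open import Relation.Binary.Definitions using (DecidableEquality)
open import Relation.Binary.PropositionalEquality
  using (_≡_; _≢_; _≗_; refl; sym; trans; cong; cong₂; subst; subst₂; module ≡-Reasoning)

open Inverse using (to; from; strictlyInverseˡ; strictlyInverseʳ)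

variable
  p q : Level
  a m n : ℕ
  B C : Set
  A₁ A₂ A₃ B₁ B₂ B₃ C₁ C₂ D₁ D₂ : Set
  F₁ : A₁ → B₁
  F₂ : A₂ → B₂
  F₃ : A₃ → B₃
  G₁ : C₁ → D₁
  G₂ : C₂ → D₂

count : {P : Pred (Fin n) p} → Decidable P → ℕ
count P? = length (filter P? (allFin _))

𝟙 : {P : Set p} → Dec P → ℕ
𝟙 (yes _) = 1
𝟙 (no _) = 0

length-filter-tabulate : {A : Set} {P : Pred A p} (P? : Decidable P) (f : Fin n → A) →
                         length (filter P? (tabulate f)) ≡ sum (𝟙 ∘ P? ∘ f)
length-filter-tabulate {n = zero} P? f = refl
length-filter-tabulate {n = suc n} P? f with P? (f zero)
... | yes _ = cong suc (length-filter-tabulate P? (f ∘ suc))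
... | no _ = length-filter-tabulate P? (f ∘ suc)

count≡sum : {P : Pred (Fin n) p} (P? : Decidable P) → count P? ≡ sum (𝟙 ∘ P?)
count≡sum P? = length-filter-tabulate P? (λ x → x)

sum-↑ : ∀ m (t : Fin (m + n) → ℕ) → sum t ≡ sum (t ∘ (_↑ˡ n)) + sum (t ∘ (m ↑ʳ_))
sum-↑ zero t = refl
sum-↑ (suc m) t = trans (cong (t zero +_) (sum-↑ m (t ∘ suc))) (sym (+-assoc (t zero) _ _))

module _ {P : Pred (Fin n) p} (P? : Decidable P) where

  count-permute : (π : Fin m ↔ Fin n) → count P? ≡ count (P? ∘ to π)
  count-permute π = begin
    count P?             ≡⟨ count≡sum P? ⟩
    sum (𝟙 ∘ P?)         ≡⟨ sum-permute (𝟙 ∘ P?) π ⟩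
    sum (𝟙 ∘ P? ∘ to π)  ≡⟨ count≡sum (P? ∘ to π) ⟨
    count (P? ∘ to π)    ∎
    where open ≡-Reasoning

  count-none : (∀ x → ¬ P x) → count P? ≡ 0
  count-none ¬P = cong length (filter-none P? (All.tabulate⁺ ¬P))

  count-all : (∀ x → P x) → count P? ≡ n
  count-all all = trans (cong length (filter-all P? (All.tabulate⁺ all))) (length-tabulate _)

  count-cong : {Q : Pred (Fin n) q} (Q? : Decidable Q) → P ≐ Q → count P? ≡ count Q?
  count-cong Q? P≐Q = cong length (filter-≐ P? Q? P≐Q (allFin n))

count-↑ : ∀ m {n} {P : Pred (Fin (m + n)) p} (P? : Decidable P) →
          count P? ≡ count (P? ∘ (_↑ˡ n)) + count (P? ∘ (m ↑ʳ_))
count-↑ m {n} P? = begin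
  count P?
    ≡⟨ count≡sum P? ⟩
  sum (𝟙 ∘ P?)
    ≡⟨ sum-↑ m (𝟙 ∘ P?) ⟩
  sum (𝟙 ∘ P? ∘ (_↑ˡ n)) + sum (𝟙 ∘ P? ∘ (m ↑ʳ_))
    ≡⟨ cong₂ _+_ (count≡sum (P? ∘ (_↑ˡ n))) (count≡sum (P? ∘ (m ↑ʳ_))) ⟨
  count (P? ∘ (_↑ˡ n)) + count (P? ∘ (m ↑ʳ_)) ∎
  where open ≡-Reasoning

module _ {A : Set} (_≟ᴬ_ : DecidableEquality A) where

  count-≗ : {F G : Fin n → A} → F ≗ G → ∀ c → count (λ x → F x ≟ᴬ c) ≡ count (λ x → G x ≟ᴬ c)
  count-≗ {F = F} {G} F≗G c =
    count-cong (λ x → F x ≟ᴬ c) (λ x → G x ≟ᴬ c) ((λ {x} e → trans (sym (F≗G x)) e) , (λ {x} e → trans (F≗G x) e))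

  count-injective : {B : Set} (_≟ᴮ_ : DecidableEquality B) {ι : B → A} → Injective _≡_ _≡_ ι →
                    (F : Fin n → B) → ∀ c → count (λ x → ι (F x) ≟ᴬ ι c) ≡ count (λ x → F x ≟ᴮ c)
  count-injective _≟ᴮ_ {ι} ι-injective F c =
    count-cong (λ x → ι (F x) ≟ᴬ ι c) (λ x → F x ≟ᴮ c) (ι-injective , cong ι)

-- Maps up to bijections of source and target

-- The source bijection points backwards, as ξ₁ does in _≽_.
record _≅_ {A B A′ B′ : Set} (F : A → B) (G : A′ → B′) : Set where
  field
    source   : A′ ↔ A
    target   : B ↔ B′
    commutes : ∀ x → to target (F (to source x)) ≡ G x
open _≅_

≗⇒≅ : {F G : A₁ → B₁} → F ≗ G → F ≅ G
≗⇒≅ F≗G = record { source = ↔-refl ; target = ↔-refl ; commutes = F≗G }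

≅-refl : F₁ ≅ F₁
≅-refl = ≗⇒≅ (λ _ → refl)

≅-sym : F₁ ≅ F₂ → F₂ ≅ F₁
≅-sym {F₁ = F} {F₂ = G} R = record
  { source   = ↔-sym (source R)
  ; target   = ↔-sym (target R)
  ; commutes = λ x → begin
      from (target R) (G (from (source R) x))
        ≡⟨ cong (from (target R)) (commutes R (from (source R) x)) ⟨
      from (target R) (to (target R) (F (to (source R) (from (source R) x))))
        ≡⟨ strictlyInverseʳ (target R) _ ⟩
      F (to (source R) (from (source R) x))
        ≡⟨ cong F (strictlyInverseˡ (source R) x) ⟩
      F x ∎
  }
  where open ≡-Reasoning

≅-trans : F₁ ≅ F₂ → F₂ ≅ F₃ → F₁ ≅ F₃
≅-trans R S = record
  { source   = ↔-trans (source S) (source R)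
  ; target   = ↔-trans (target R) (target S)
  ; commutes = λ x → trans (cong (to (target S)) (commutes R (to (source S) x))) (commutes S x)
  }

∘-≅ : (e : B₁ ↔ B₂) → F₁ ≅ (to e ∘ F₁)
∘-≅ e = record { source = ↔-refl ; target = e ; commutes = λ _ → refl }

map-≅ : F₁ ≅ G₁ → F₂ ≅ G₂ → Sum.map F₁ F₂ ≅ Sum.map G₁ G₂
map-≅ R S = record
  { source   = ⊎-cong (source R) (source S)
  ; target   = ⊎-cong (target R) (target S)
  ; commutes = λ { (inj₁ x) → cong inj₁ (commutes R x) ; (inj₂ y) → cong inj₂ (commutes S y) }
  }

map-comm : Sum.map F₁ F₂ ≅ Sum.map F₂ F₁
map-comm = record
  { source   = ⊎-comm _ _
  ; target   = ⊎-comm _ _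
  ; commutes = λ { (inj₁ x) → refl ; (inj₂ y) → refl }
  }

map-assoc : Sum.map (Sum.map F₁ F₂) F₃ ≅ Sum.map F₁ (Sum.map F₂ F₃)
map-assoc = record
  { source   = ↔-sym (⊎-assoc _ _ _ _)
  ; target   = ⊎-assoc _ _ _ _
  ; commutes = λ { (inj₁ x) → refl ; (inj₂ (inj₁ y)) → refl ; (inj₂ (inj₂ z)) → refl }
  }

⊔≅map : ∀ f g → fun (f ⊔ g) ≅ Sum.map (fun f) (fun g)
⊔≅map f g = record
  { source   = ↔-sym +↔⊎
  ; target   = +↔⊎
  ; commutes = λ x → begin
      splitAt (cod f) (join (cod f) (cod g) (Sum.map (fun f) (fun g) (splitAt (dom f) (join (dom f) (dom g) x))))
        ≡⟨ splitAt-join (cod f) (cod g) _ ⟩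
      Sum.map (fun f) (fun g) (splitAt (dom f) (join (dom f) (dom g) x))
        ≡⟨ cong (Sum.map (fun f) (fun g)) (splitAt-join (dom f) (dom g) x) ⟩
      Sum.map (fun f) (fun g) x ∎
  }
  where open ≡-Reasoning

record _≃_ (f g : FinFun) : Set where
  constructor mk≃
  field arrowIso : fun f ≅ fun g
open _≃_

≃-refl : ∀ {f} → f ≃ f
≃-refl = mk≃ ≅-refl

≃-sym : ∀ {f g} → f ≃ g → g ≃ f
≃-sym (mk≃ R) = mk≃ (≅-sym R)

≃-trans : ∀ {f g h} → f ≃ g → g ≃ h → f ≃ h
≃-trans (mk≃ R) (mk≃ S) = mk≃ (≅-trans R S)

⊔-cong : ∀ {f f′ g g′} → f ≃ f′ → g ≃ g′ → (f ⊔ g) ≃ (f′ ⊔ g′)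
⊔-cong {f} {f′} {g} {g′} (mk≃ R) (mk≃ S) =
  mk≃ (≅-trans (⊔≅map f g) (≅-trans (map-≅ R S) (≅-sym (⊔≅map f′ g′))))

⊔-comm : ∀ f g → (f ⊔ g) ≃ (g ⊔ f)
⊔-comm f g = mk≃ (≅-trans (⊔≅map f g) (≅-trans map-comm (≅-sym (⊔≅map g f))))

⊔-assoc : ∀ f g h → ((f ⊔ g) ⊔ h) ≃ (f ⊔ (g ⊔ h))
⊔-assoc f g h = mk≃
  (≅-trans (⊔≅map (f ⊔ g) h)
  (≅-trans (map-≅ (⊔≅map f g) ≅-refl)
  (≅-trans map-assoc
  (≅-trans (map-≅ ≅-refl (≅-sym (⊔≅map g h)))
           (≅-sym (⊔≅map f (g ⊔ h)))))))

-- Normal form: disjoint unions of collapsing maps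

cons-↔ˡ : (Fin m ⊎ Fin n) ↔ Fin a → (Fin (suc m) ⊎ Fin n) ↔ Fin (suc a)
cons-↔ˡ e =
  ↔-trans (⊎-cong +↔⊎ ↔-refl) (↔-trans (⊎-assoc _ _ _ _) (↔-trans (⊎-cong ↔-refl e) (↔-sym +↔⊎)))

cons-↔ʳ : (Fin m ⊎ Fin n) ↔ Fin a → (Fin m ⊎ Fin (suc n)) ↔ Fin (suc a)
cons-↔ʳ e = ↔-trans (⊎-comm _ _) (cons-↔ˡ (↔-trans (⊎-comm _ _) e))

record Splitting (h : Fin a → B ⊎ C) : Set where
  constructor splitting
  field
    {sizeˡ sizeʳ} : ℕ
    left   : Fin sizeˡ → B
    right  : Fin sizeʳ → C
    domain : (Fin sizeˡ ⊎ Fin sizeʳ) ↔ Fin a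
    splits : ∀ w → h (to domain w) ≡ Sum.map left right w

split : (h : Fin a → B ⊎ C) → Splitting h
split {zero} h = splitting {sizeˡ = 0} {sizeʳ = 0} (λ ()) (λ ()) (↔-sym +↔⊎) (λ { (inj₁ ()) ; (inj₂ ()) })
split {suc a} h with split (h ∘ suc) | h zero in eq
... | splitting g k e g⊎k | inj₁ b = splitting (b Vector.∷ g) k (cons-↔ˡ e)
  (λ { (inj₁ zero) → eq ; (inj₁ (suc u)) → g⊎k (inj₁ u) ; (inj₂ v) → g⊎k (inj₂ v) })
... | splitting g k e g⊎k | inj₂ c = splitting g (c Vector.∷ k) (cons-↔ʳ e)
  (λ { (inj₂ zero) → eq ; (inj₂ (suc v)) → g⊎k (inj₂ v) ; (inj₁ u) → g⊎k (inj₁ u) })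

collapse : ℕ → FinFun
collapse k = mkFun k 1 (λ _ → zero)

collapses : List ℕ → FinFun
collapses []       = mkFun 0 0 (λ ())
collapses (k ∷ ks) = collapse k ⊔ collapses ks

normalForm : ∀ {a b} (h : Fin a → Fin b) → ∃ λ ks → mkFun a b h ≃ collapses ks
normalForm {zero}  {zero}  h = [] , mk≃ (≗⇒≅ (λ ()))
normalForm {suc a} {zero}  h with () ← h zero
normalForm {b = suc b} h with split (splitAt 1 ∘ h)
... | splitting {m} g k e g⊎k with normalForm k
... | ks , mk≃ k≅ = m ∷ ks , mk≃
  (≅-trans (∘-≅ +↔⊎)
  (≅-trans (record { source = e ; target = ↔-refl ; commutes = g⊎k })
  (≅-trans (map-≅ (≗⇒≅ (λ u → onlyZero (g u))) k≅)
           (≅-sym (⊔≅map (collapse m) (collapses ks))))))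
  where
  onlyZero : (y : Fin 1) → y ≡ zero
  onlyZero zero = refl

idFun≃ : ∀ n → idFun n ≃ collapses (replicate n 1)
idFun≃ zero    = mk≃ (≗⇒≅ (λ ()))
idFun≃ (suc n) =
  ≃-trans (mk≃ (≗⇒≅ λ { zero → refl ; (suc x) → refl })) (⊔-cong (≃-refl {collapse 1}) (idFun≃ n))

collapses-++ : ∀ xs ys → collapses (xs ++ ys) ≃ (collapses xs ⊔ collapses ys)
collapses-++ []       ys = ≃-refl
collapses-++ (x ∷ xs) ys =
  ≃-trans (⊔-cong ≃-refl (collapses-++ xs ys)) (≃-sym (⊔-assoc (collapse x) (collapses xs) (collapses ys)))

collapses-↭ : ∀ {xs ys} → xs ↭ ys → collapses xs ≃ collapses ys
collapses-↭ ↭.refl = ≃-refl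
collapses-↭ (↭.prep x p) = ⊔-cong ≃-refl (collapses-↭ p)
collapses-↭ {x ∷ y ∷ xs} {.y ∷ .x ∷ ys} (↭.swap x y p) =
  ≃-trans (≃-sym (⊔-assoc (collapse x) (collapse y) (collapses xs)))
  (≃-trans (⊔-cong (⊔-comm (collapse x) (collapse y)) (collapses-↭ p))
           (⊔-assoc (collapse y) (collapse x) (collapses ys)))
collapses-↭ (↭.trans p q) = ≃-trans (collapses-↭ p) (collapses-↭ q)

↑ˡ≢↑ʳ : ∀ {m n} (x : Fin m) (y : Fin n) → x ↑ˡ n ≢ m ↑ʳ y
↑ˡ≢↑ʳ zero    y ()
↑ˡ≢↑ʳ (suc x) y eq = ↑ˡ≢↑ʳ x y (suc-injective eq)

⊔-↑ˡ : ∀ f g x → fun (f ⊔ g) (x ↑ˡ dom g) ≡ fun f x ↑ˡ cod g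
⊔-↑ˡ f g x = cong (join (cod f) (cod g) ∘ Sum.map (fun f) (fun g)) (splitAt-↑ˡ (dom f) x (dom g))

⊔-↑ʳ : ∀ f g x → fun (f ⊔ g) (dom f ↑ʳ x) ≡ cod f ↑ʳ fun g x
⊔-↑ʳ f g x = cong (join (cod f) (cod g) ∘ Sum.map (fun f) (fun g)) (splitAt-↑ʳ (dom f) (dom g) x)

fiberSize-⊔ˡ : ∀ f g y → fiberSize (f ⊔ g) (y ↑ˡ cod g) ≡ fiberSize f y
fiberSize-⊔ˡ f g y = begin
  fiberSize (f ⊔ g) (y ↑ˡ cod g)
    ≡⟨ count-↑ (dom f) _ ⟩
  count (λ x → fun (f ⊔ g) (x ↑ˡ dom g) Fin.≟ y ↑ˡ cod g)
    + count (λ x → fun (f ⊔ g) (dom f ↑ʳ x) Fin.≟ y ↑ˡ cod g)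
    ≡⟨ cong₂ _+_ (count-≗ Fin._≟_ (⊔-↑ˡ f g) _) (count-none _ misses) ⟩
  count (λ x → fun f x ↑ˡ cod g Fin.≟ y ↑ˡ cod g) + 0
    ≡⟨ cong (_+ 0) (count-injective Fin._≟_ Fin._≟_ (↑ˡ-injective (cod g) _ _) (fun f) y) ⟩
  fiberSize f y + 0
    ≡⟨ +-identityʳ _ ⟩
  fiberSize f y ∎
  where
  open ≡-Reasoning
  misses : ∀ x → fun (f ⊔ g) (dom f ↑ʳ x) ≢ y ↑ˡ cod g
  misses x e = ↑ˡ≢↑ʳ y (fun g x) (trans (sym e) (⊔-↑ʳ f g x))

fiberSize-⊔ʳ : ∀ f g y → fiberSize (f ⊔ g) (cod f ↑ʳ y) ≡ fiberSize g y
fiberSize-⊔ʳ f g y = begin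
  fiberSize (f ⊔ g) (cod f ↑ʳ y)
    ≡⟨ count-↑ (dom f) _ ⟩
  count (λ x → fun (f ⊔ g) (x ↑ˡ dom g) Fin.≟ cod f ↑ʳ y)
    + count (λ x → fun (f ⊔ g) (dom f ↑ʳ x) Fin.≟ cod f ↑ʳ y)
    ≡⟨ cong₂ _+_ (count-none _ misses) (count-≗ Fin._≟_ (⊔-↑ʳ f g) _) ⟩
  0 + count (λ x → cod f ↑ʳ fun g x Fin.≟ cod f ↑ʳ y)
    ≡⟨ count-injective Fin._≟_ Fin._≟_ (↑ʳ-injective (cod f) _ _) (fun g) y ⟩
  fiberSize g y ∎
  where
  open ≡-Reasoning
  misses : ∀ x → fun (f ⊔ g) (x ↑ˡ dom g) ≢ cod f ↑ʳ y
  misses x e = ↑ˡ≢↑ʳ (fun f x) y (trans (sym (⊔-↑ˡ f g x)) e)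

φ-⊔ : ∀ i f g → φ i (f ⊔ g) ≡ φ i f + φ i g
φ-⊔ i f g =
  trans (count-↑ (cod f) _) (cong₂ _+_ (count-≗ _≟_ (fiberSize-⊔ˡ f g) i) (count-≗ _≟_ (fiberSize-⊔ʳ f g) i))

fiberSize-≃ : ∀ {f g} (R : f ≃ g) y → fiberSize g (to (target (arrowIso R)) y) ≡ fiberSize f y
fiberSize-≃ {f} {g} (mk≃ R) y = begin
  fiberSize g (to (target R) y)
    ≡⟨ count-≗ Fin._≟_ (λ x → sym (commutes R x)) _ ⟩
  count (λ x → to (target R) (fun f (to (source R) x)) Fin.≟ to (target R) y)
    ≡⟨ count-injective Fin._≟_ Fin._≟_ (Injection.injective (↔⇒↣ (target R))) (fun f ∘ to (source R)) y ⟩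
  count (λ x → fun f (to (source R) x) Fin.≟ y)
    ≡⟨ count-permute _ (source R) ⟨
  fiberSize f y ∎
  where open ≡-Reasoning

φ-≃ : ∀ i {f g} → f ≃ g → φ i f ≡ φ i g
φ-≃ i R = sym (trans (count-permute _ (target (arrowIso R))) (count-≗ _≟_ (fiberSize-≃ R) i))

-- Multisets of fibre sizes

multiplicity : ℕ → List ℕ → ℕ
multiplicity i = length ∘ filter (_≟ i)

multiplicity-++ : ∀ i xs ys → multiplicity i (xs ++ ys) ≡ multiplicity i xs + multiplicity i ys
multiplicity-++ i xs ys = trans (cong length (filter-++ (_≟ i) xs ys)) (length-++ (filter (_≟ i) xs))

multiplicity-∷ : ∀ i x xs → multiplicity i (x ∷ xs) ≡ multiplicity i (x ∷ []) + multiplicity i xs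
multiplicity-∷ i x = multiplicity-++ i (x ∷ [])

multiplicity-↭ : ∀ i {xs ys} → xs ↭ ys → multiplicity i xs ≡ multiplicity i ys
multiplicity-↭ i p = ↭-length (filter-↭ (_≟ i) p)

multiplicity-replicate : ∀ n i → multiplicity i (replicate n i) ≡ n
multiplicity-replicate n i = trans (cong length (filter-all (_≟ i) (All.replicate⁺ n refl))) (length-replicate n)

multiplicity-replicate-≢ : ∀ n {k i} → k ≢ i → multiplicity i (replicate n k) ≡ 0
multiplicity-replicate-≢ n {i = i} k≢i = cong length (filter-none (_≟ i) (All.replicate⁺ n k≢i))

multiplicity>0⇒↭∷ : ∀ x ys → 0 < multiplicity x ys → ∃ λ ys′ → ys ↭ x ∷ ys′
multiplicity>0⇒↭∷ x (y ∷ ys) pos with y ≟ x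
... | yes refl = ys , ↭-refl
... | no y≢x
  with ys′ , p ← multiplicity>0⇒↭∷ x ys (subst (0 <_) (cong length (filter-reject (_≟ x) y≢x)) pos)
  = y ∷ ys′ , ↭-trans (↭-prep y p) (↭-swap y x ↭-refl)

multiplicity-head>0 : ∀ x xs → 0 < multiplicity x (x ∷ xs)
multiplicity-head>0 x xs = subst (0 <_) (cong length (sym (filter-accept (_≟ x) refl))) (s≤s z≤n)

submultiset-complement : ∀ xs ys → (∀ i → multiplicity i xs ≤ multiplicity i ys) → ∃ λ zs → ys ↭ xs ++ zs
submultiset-complement []       ys _  = ys , ↭-refl
submultiset-complement (x ∷ xs) ys xs≤ys
  with ys′ , ys↭ ← multiplicity>0⇒↭∷ x ys (≤-trans (multiplicity-head>0 x xs) (xs≤ys x))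
  with zs , ys′↭ ← submultiset-complement xs ys′ (λ i → +-cancelˡ-≤ (multiplicity i (x ∷ [])) _ _
         (subst₂ _≤_ (multiplicity-∷ i x xs) (trans (multiplicity-↭ i ys↭) (multiplicity-∷ i x ys′)) (xs≤ys i)))
  = zs , ↭-trans ys↭ (↭-prep x ys′↭)

dominated-after-padding-ones : ∀ xs ys → (∀ i → i ≢ 1 → multiplicity i ys ≤ multiplicity i xs) →
                               ∀ i → multiplicity i ys ≤ multiplicity i (xs ++ replicate (multiplicity 1 ys) 1)
dominated-after-padding-ones xs ys ys≤xs i = begin
  multiplicity i ys                        ≤⟨ bound ⟩
  multiplicity i xs + multiplicity i ones  ≡⟨ multiplicity-++ i xs ones ⟨
  multiplicity i (xs ++ ones)              ∎
  where
  open ≤-Reasoning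
  ones : List ℕ
  ones = replicate (multiplicity 1 ys) 1
  bound : multiplicity i ys ≤ multiplicity i xs + multiplicity i ones
  bound with i ≟ 1
  ... | yes refl = begin
    multiplicity 1 ys                       ≤⟨ m≤n+m _ _ ⟩
    multiplicity 1 xs + multiplicity 1 ys   ≡⟨ cong (multiplicity 1 xs +_) (multiplicity-replicate _ 1) ⟨
    multiplicity 1 xs + multiplicity 1 ones ∎
  ... | no i≢1 = begin
    multiplicity i ys
      ≤⟨ ys≤xs i i≢1 ⟩
    multiplicity i xs
      ≡⟨ +-identityʳ _ ⟨
    multiplicity i xs + 0
      ≡⟨ cong (multiplicity i xs +_) (multiplicity-replicate-≢ (multiplicity 1 ys) (i≢1 ∘ sym)) ⟨
    multiplicity i xs + multiplicity i ones ∎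

φ-collapse : ∀ i k → φ i (collapse k) ≡ multiplicity i (k ∷ [])
φ-collapse i k = trans (count-≗ _≟_ fiberSize-collapse i) (count-singleton (k ≟ i))
  where
  fiberSize-collapse : ∀ y → fiberSize (collapse k) y ≡ k
  fiberSize-collapse zero = count-all _ (λ _ → refl)
  count-singleton : ∀ k≟i → count {1} (λ _ → k≟i) ≡ multiplicity i (k ∷ [])
  count-singleton (yes k≡i) = cong length (sym (filter-accept (_≟ i) k≡i))
  count-singleton (no k≢i)  = cong length (sym (filter-reject (_≟ i) k≢i))

φ-collapses : ∀ i ks → φ i (collapses ks) ≡ multiplicity i ks
φ-collapses i []       = refl
φ-collapses i (k ∷ ks) = begin
  φ i (collapse k ⊔ collapses ks)               ≡⟨ φ-⊔ i (collapse k) (collapses ks) ⟩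
  φ i (collapse k) + φ i (collapses ks)         ≡⟨ cong₂ _+_ (φ-collapse i k) (φ-collapses i ks) ⟩
  multiplicity i (k ∷ []) + multiplicity i ks   ≡⟨ multiplicity-∷ i k ks ⟨
  multiplicity i (k ∷ ks)                       ∎
  where open ≡-Reasoning

φ-≃-collapses : ∀ i {f ks} → f ≃ collapses ks → φ i f ≡ multiplicity i ks
φ-≃-collapses i {ks = ks} f≃ = trans (φ-≃ i f≃) (φ-collapses i ks)

φ-idFun : ∀ {i} → i ≢ 1 → ∀ n → φ i (idFun n) ≡ 0
φ-idFun i≢1 n = trans (φ-≃-collapses _ (idFun≃ n)) (multiplicity-replicate-≢ n (i≢1 ∘ sym))

-- Monotonicity and completeness

≽⇒≃ : ∀ {f g} → f ≽ g → ∃ λ z → ∃ λ j → (f ⊔ idFun z) ≃ (g ⊔ j)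
≽⇒≃ (z , j , ξ₁ , ξ₂ , ξ₂∘f∘ξ₁≗g) =
  z , j , mk≃ record { source = ⤖⇒↔ ξ₁ ; target = ⤖⇒↔ ξ₂ ; commutes = ξ₂∘f∘ξ₁≗g }

≃⇒≽ : ∀ {f g z j} → (f ⊔ idFun z) ≃ (g ⊔ j) → f ≽ g
≃⇒≽ {z = z} {j} (mk≃ R) = z , j , ↔⇒⤖ (source R) , ↔⇒⤖ (target R) , commutes R

φ-mono : ∀ {i} → i ≢ 1 → ∀ {f g} → f ≽ g → φ i g ≤ φ i f
φ-mono {i} i≢1 {f} {g} f≽g with z , j , R ← ≽⇒≃ f≽g = begin
  φ i g                        ≤⟨ m≤m+n _ _ ⟩
  φ i g + φ i j                ≡⟨ φ-⊔ i g j ⟨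
  φ i (g ⊔ j)                  ≡⟨ φ-≃ i R ⟨
  φ i (f ⊔ idFun z)            ≡⟨ φ-⊔ i f (idFun z) ⟩
  φ i f + φ i (idFun z)        ≡⟨ cong (φ i f +_) (φ-idFun i≢1 z) ⟩
  φ i f + 0                    ≡⟨ +-identityʳ _ ⟩
  φ i f                        ∎
  where open ≤-Reasoning

≽-complete : ∀ f g → (∀ i → i ≢ 1 → φ i g ≤ φ i f) → f ≽ g
≽-complete f g φg≤φf =
  let kf , f≃ = normalForm (fun f)
      kg , g≃ = normalForm (fun g)
      z = multiplicity 1 kg
      kg≤kf : ∀ i → i ≢ 1 → multiplicity i kg ≤ multiplicity i kf
      kg≤kf i i≢1 = subst₂ _≤_ (φ-≃-collapses i g≃) (φ-≃-collapses i f≃) (φg≤φf i i≢1)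
      rest , perm = submultiset-complement kg (kf ++ replicate z 1) (dominated-after-padding-ones kf kg kg≤kf)
  in ≃⇒≽ (≃-trans (⊔-cong f≃ (idFun≃ z))
         (≃-trans (≃-sym (collapses-++ kf (replicate z 1)))
         (≃-trans (collapses-↭ perm)
         (≃-trans (collapses-++ kg rest)
                  (⊔-cong (≃-sym g≃) ≃-refl)))))

proposition4p1 :
    (∀ i → i ≢ 1 →
      (∀ f g → f ≽ g → g ≽ f → φ i f ≡ φ i g)
      × (∀ f g → f ≽ g → φ i f ≥ φ i g)
      × (∀ f g → φ i (f ⊔ g) ≡ φ i f + φ i g)
      × (∀ n → φ i (idFun n) ≡ 0))
    × (∀ f g → (f ≽ g) ⇔ (∀ i → i ≢ 1 → φ i f ≥ φ i g))
proposition4p1 =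
  (λ i i≢1 → (λ f g f≽g g≽f → ≤-antisym (φ-mono i≢1 g≽f) (φ-mono i≢1 f≽g))
           , (λ f g → φ-mono i≢1)
           , φ-⊔ i
           , φ-idFun i≢1)
  , λ f g → mk⇔ (λ f≽g i i≢1 → φ-mono i≢1 f≽g) (≽-complete f g)
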